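{- Let $q>1$ be odd and $p=2$. For all $U\in\mathbb{N}$, $$W(qU)\ge W(qU+1)\ge W(qU-1),$$ and for $0\le r<q-1$, $W(qU+r)\ge W(qU+r+1)$.
   Context: A strictly chained $(2,q)$-ary partition of $U$ is a finite sequence of distinct positive integers of the form $2^aq^b$ ($a,b\ge0$) summing to $U$, in decreasing order, each part a multiple of the next. $W(U)$ is the number of such partitions of $U$, with $W(0)=1$ and $W(x)=0$ if $x$ is not a nonnegative integer (so $W(-1)=0$). -}

module Defs where

open import Data.Nat using (ℕ; zero; suc; _+_; _*_; _^_; _≤_; _<_; z≤n; s≤s; _≤?_; _<?_; _≟_)
open import Data.Nat.Properties
open import Data.Nat.Divisibility using (_∣_; _∣?_)
open import Data.Integer using (ℤ; +_; -[1+_])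
open import Data.List using (List; []; _∷_; [_]; map; _++_; length; filter)
open import Data.Nat.ListAction using (sum)
open import Data.List.Relation.Unary.All using (All; all?)
open import Data.List.Relation.Unary.Linked using (Linked; linked?)
open import Data.Fin using (Fin; toℕ; fromℕ<)
open import Data.Fin.Properties using (any?; toℕ-fromℕ<)
open import Data.Product using (Σ; ∃; ∃₂; _×_; _,_; proj₁; proj₂)
open import Data.Empty using (⊥-elim)
open import Relation.Nullary using (Dec; yes; no; ¬_)
open import Relation.Nullary.Decidable using (_×-dec_; map′)
open import Relation.Binary.PropositionalEquality using (_≡_; refl; sym; trans; cong; subst)

Is2qNumber : ℕ → ℕ → Set
Is2qNumber q n = ∃₂ λ a b → 2 ^ a * q ^ b ≡ n

IsPart : ℕ → ℕ → Set
IsPart q n = 0 < n × Is2qNumber q n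

-- consecutive parts x, y (x written before y): y < x (strictly decreasing,
-- hence distinct) and x is a multiple of y
ChainStep : ℕ → ℕ → Set
ChainStep x y = y < x × y ∣ x

IsSCPartition : ℕ → ℕ → List ℕ → Set
IsSCPartition q U l = All (IsPart q) l × Linked ChainStep l × sum l ≡ U

private
  n<2^n : ∀ n → n < 2 ^ n
  n<2^n zero = s≤s z≤n
  n<2^n (suc n) = ≤-trans (s≤s (n<2^n n))
    (≤-trans (≤-reflexive (+-comm 1 (2 ^ n))) (+-monoʳ-≤ (2 ^ n) (≤-trans (m^n>0 2 n) (m≤m+n (2 ^ n) 0))))

  n<m^n : ∀ m n → 2 ≤ m → n < m ^ n
  n<m^n m n 2≤m = ≤-trans (n<2^n n) (^-monoˡ-≤ n 2≤m)

  pos : ∀ {x} → 0 < x → 1 ≤ x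
  pos p = p

  B : ℕ → ℕ → Set
  B q n = Σ (Fin (suc n)) λ i → Σ (Fin (suc n)) λ j → 2 ^ toℕ i * q ^ toℕ j ≡ n

  B? : ∀ q n → Dec (B q n)
  B? q n = any? λ i → any? λ j → 2 ^ toℕ i * q ^ toℕ j ≟ n

  B⇒ : ∀ {q n} → B q n → Is2qNumber q n
  B⇒ (i , j , e) = toℕ i , toℕ j , e

  ≤* : ∀ x y → 0 < x * y → x ≤ x * y
  ≤* x zero p = ⊥-elim (<-irrefl (sym (*-zeroʳ x)) p)
  ≤* x (suc y) _ = m≤m*n x (suc y)

  ≤*ʳ : ∀ x y → 0 < x * y → y ≤ x * y
  ≤*ʳ x y p = subst (y ≤_) (*-comm y x) (≤* y x (subst (0 <_) (*-comm x y) p))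

  mk : ∀ {q n} a b → a < suc n → b < suc n → 2 ^ a * q ^ b ≡ n → B q n
  mk {q} {n} a b a< b< e =
    fromℕ< a< , fromℕ< b<
    , subst (λ k → 2 ^ k * q ^ toℕ (fromℕ< b<) ≡ n) (sym (toℕ-fromℕ< a<))
        (subst (λ k → 2 ^ a * q ^ k ≡ n) (sym (toℕ-fromℕ< b<)) e)

  ⇒B : ∀ q n → 0 < n → Is2qNumber q n → B q n
  ⇒B q n p (a , b , e) = go q b e
    where
    a≤ : ∀ {c} → 2 ^ a * c ≡ n → a < suc n
    a≤ {c} e' = s≤s (<⇒≤ (≤-trans (n<2^n a)
                  (≤-trans (≤* (2 ^ a) c (subst (0 <_) (sym e') p)) (≤-reflexive e'))))
    go : ∀ q b → 2 ^ a * q ^ b ≡ n → B q n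
    go zero zero e' = mk a 0 (a≤ e') (s≤s z≤n) e'
    go zero (suc b) e' with () ← <-irrefl (trans (sym (*-zeroʳ (2 ^ a))) e') p
    go (suc zero) b e' =
      mk a 0 (a≤ e') (s≤s z≤n) (trans (cong (2 ^ a *_) (sym (^-zeroˡ b))) e')
    go q@(suc (suc _)) b e' =
      mk a b (a≤ e') (s≤s (<⇒≤ (≤-trans (n<m^n q b (s≤s (s≤s z≤n)))
                 (≤-trans (≤*ʳ (2 ^ a) (q ^ b) (subst (0 <_) (sym e') p)) (≤-reflexive e')))))
        e'

isPart? : ∀ q n → Dec (IsPart q n)
isPart? q n with 0 <? n
... | no ¬p = no λ x → ¬p (proj₁ x)
... | yes p = map′ (λ b → p , B⇒ b) (λ x → ⇒B q n p (proj₂ x)) (B? q n)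

chainStep? : ∀ x y → Dec (ChainStep x y)
chainStep? x y = (y <? x) ×-dec (y ∣? x)

isSCPartition? : ∀ q U l → Dec (IsSCPartition q U l)
isSCPartition? q U l = all? (isPart? q) l ×-dec (linked? chainStep? l ×-dec (sum l ≟ U))

sublists : {A : Set} → List A → List (List A)
sublists [] = [ [] ]
sublists (x ∷ xs) = map (x ∷_) (sublists xs) ++ sublists xs

downFrom1 : ℕ → List ℕ
downFrom1 zero = []
downFrom1 (suc n) = suc n ∷ downFrom1 n

-- Every such partition is a strictly decreasing list of integers in [1..U],
-- hence occurs exactly once among the sublists of [U, ..., 1].
W : ℕ → ℕ → ℕ
W q U = length (filter (isSCPartition? q U) (sublists (downFrom1 U)))

Wℤ : ℕ → ℤ → ℕ
Wℤ q (+ n) = W q n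
Wℤ q -[1+ n ] = 0

module Submission where

-- The smallest part of such a partition divides all the others, so either it is 1
-- or all parts are even or all are multiples of q.  Let A n count the partitions of
-- n without the part 1.  Deleting a final 1 gives  W (n + 1) = A (n + 1) + A n,
-- and halving all-even partitions, dividing all-q-multiple ones by q, together with
-- inclusion–exclusion, express A through W (A-coprime, A-double, A-times-q,
-- A-double-times-q, W≤A-double).  From these, strong induction proves that
-- W (n + 1) ≤ W n unless q ∣ n + 1 (W-antitone), that W k ≤ W (k + 1) + W ⌊k/q⌋
-- unless q ∣ k + 1 (W-block-bound), and finally W (n − 1) ≤ W (n + 1) for q ∣ n
-- (W-sandwich).

open import Defs

open import Data.Nat
  using (ℕ; zero; suc; NonZero; >-nonZero; z<s; _+_; _*_; _^_; _/_; _%_; _≤_; _<_; _∸_; z≤n; s≤s; _≟_; _<?_)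
open import Data.Nat.Properties
open import Data.Nat.Divisibility
  using (_∣_; _∣?_; divides; ∣-refl; ∣-trans; ∣1⇒≡1; ∣⇒≤; m∣m*n; ∣m⇒∣m*n; ∣n⇒∣m*n;
         ∣m∣n⇒∣m+n; ∣m+n∣m⇒∣n; *-monoʳ-∣; *-cancelˡ-∣)
open import Algebra.Properties.CommutativeSemigroup *-commutativeSemigroup using () renaming (x∙yz≈y∙xz to *-left-swap)
open import Algebra.Properties.CommutativeSemigroup +-commutativeSemigroup using () renaming (x∙yz≈y∙xz to +-left-swap)
open import Data.Nat.DivMod using (m≡m%n+[m/n]*n; m%n<n)
open import Data.Nat.Coprimality using (Coprime; coprime-divisor)
import Data.Nat.Coprimality as Coprimality
open import Data.Nat.Induction using (<-rec)
open import Data.Nat.ListAction using (sum)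
open import Data.Nat.ListAction.Properties using (sum-++)
open import Data.Nat.Tactic.RingSolver using (solve-∀)
open import Data.List using (List; []; _∷_; [_]; _++_; _∷ʳ_; map; filter; length; last; initLast; _∷ʳ′_)
open import Data.List.Properties
  using (length-filter; filter-all; length-map; length-++; ∷-injectiveʳ; ∷ʳ-injectiveˡ; map-injective)
open import Data.List.Membership.Propositional using (_∈_)
open import Data.List.Membership.Propositional.Properties
  using (∈-∃++; ∈-++⁺ˡ; ∈-++⁺ʳ; ∈-++⁻; ∈-map⁺; ∈-map⁻; ∈-filter⁺; ∈-filter⁻)
open import Data.List.Relation.Unary.Any using (here; there)
open import Data.List.Relation.Unary.All as All using (All; []; _∷_; all?)
import Data.List.Relation.Unary.All.Properties as All
open import Data.List.Relation.Unary.Linked as Linked using (Linked; []; [-]; _∷_)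
import Data.List.Relation.Unary.Linked.Properties as Linked
open import Data.List.Relation.Unary.AllPairs using ([]; _∷_)
open import Data.List.Relation.Unary.Unique.Propositional using (Unique)
import Data.List.Relation.Unary.Unique.Propositional.Properties as Unique
open import Data.Maybe using (just)
open import Data.Maybe.Properties using (just-injective; ≡-dec)
open import Data.Maybe.Relation.Binary.Connected using (Connected; just; nothing-just)
open import Data.Product using (∃; _×_; _,_; proj₁; proj₂)
open import Data.Sum using (_⊎_; inj₁; inj₂)
open import Data.Unit using (⊤; tt)
open import Relation.Nullary using (yes; no; ¬_; ¬?; contradiction)
open import Relation.Nullary.Decidable using (_⊎-dec_; _×-dec_)
open import Relation.Unary using (Decidable)
open import Relation.Binary.PropositionalEquality
  using (_≡_; _≢_; refl; sym; trans; cong; cong₂; subst; module ≡-Reasoning)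

length-⊆ : {A : Set} {xs ys : List A} → Unique xs → (∀ {x} → x ∈ xs → x ∈ ys) → length xs ≤ length ys
length-⊆ {xs = []} _ _ = z≤n
length-⊆ {xs = x ∷ xs} {ys} (x∉xs ∷ xs-unique) xs⊆ys with ∈-∃++ (xs⊆ys (here refl))
... | ys₁ , ys₂ , refl = begin
    suc (length xs)               ≤⟨ s≤s (length-⊆ xs-unique xs⊆ys₁++ys₂) ⟩
    suc (length (ys₁ ++ ys₂))     ≡⟨ cong suc (length-++ ys₁) ⟩
    suc (length ys₁ + length ys₂) ≡⟨ sym (+-suc (length ys₁) (length ys₂)) ⟩
    length ys₁ + length (x ∷ ys₂) ≡⟨ sym (length-++ ys₁) ⟩
    length (ys₁ ++ x ∷ ys₂)       ∎
  where
  open ≤-Reasoning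
  xs⊆ys₁++ys₂ : ∀ {v} → v ∈ xs → v ∈ ys₁ ++ ys₂
  xs⊆ys₁++ys₂ {v} v∈xs with ∈-++⁻ ys₁ (xs⊆ys (there v∈xs))
  ... | inj₁ v∈ys₁         = ∈-++⁺ˡ v∈ys₁
  ... | inj₂ (here v≡x)    = contradiction (sym v≡x) (All.lookup x∉xs v∈xs)
  ... | inj₂ (there v∈ys₂) = ∈-++⁺ʳ ys₁ v∈ys₂

length-injection : {A B : Set} {xs : List A} {ys : List B} (f : A → B) →
  (∀ {x y} → f x ≡ f y → x ≡ y) → Unique xs → (∀ {x} → x ∈ xs → f x ∈ ys) →
  length xs ≤ length ys
length-injection {xs = xs} f f-injective xs-unique maps-into =
  subst (_≤ _) (length-map f xs) (length-⊆ (Unique.map⁺ f-injective xs-unique) image⊆ys)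
  where
  image⊆ys : ∀ {y} → y ∈ map f xs → y ∈ _
  image⊆ys y∈image with ∈-map⁻ f y∈image
  ... | x , x∈xs , refl = maps-into x∈xs

length-surjection : {A B : Set} {xs : List A} {ys : List B} (f : A → B) →
  Unique ys → (∀ {y} → y ∈ ys → ∃ λ x → x ∈ xs × f x ≡ y) → length ys ≤ length xs
length-surjection {xs = xs} f ys-unique onto =
  subst (_ ≤_) (length-map f xs) (length-⊆ ys-unique ys⊆image)
  where
  ys⊆image : ∀ {y} → y ∈ _ → y ∈ map f xs
  ys⊆image y∈ys with onto y∈ys
  ... | x , x∈xs , refl = ∈-map⁺ f x∈xs

module _ {A : Set} {P Q : A → Set} (P? : Decidable P) (Q? : Decidable Q) where

  length-filter-⊎ : ∀ xs →
    length (filter (λ x → P? x ⊎-dec Q? x) xs) + length (filter (λ x → P? x ×-dec Q? x) xs)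
      ≡ length (filter P? xs) + length (filter Q? xs)
  length-filter-⊎ [] = refl
  length-filter-⊎ (x ∷ xs) with P? x | Q? x
  ... | yes _ | yes _ = cong suc (trans (+-suc _ _) (trans (cong suc (length-filter-⊎ xs)) (sym (+-suc _ _))))
  ... | yes _ | no _  = cong suc (length-filter-⊎ xs)
  ... | no _  | yes _ = trans (cong suc (length-filter-⊎ xs)) (sym (+-suc _ _))
  ... | no _  | no _  = length-filter-⊎ xs

length-filter-¬ : {A : Set} {P : A → Set} (P? : Decidable P) → ∀ xs →
  length xs ≡ length (filter P? xs) + length (filter (λ x → ¬? (P? x)) xs)
length-filter-¬ P? [] = refl
length-filter-¬ P? (x ∷ xs) with P? x
... | yes _ = cong suc (length-filter-¬ P? xs)
... | no _  = trans (cong suc (length-filter-¬ P? xs)) (sym (+-suc _ _))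

last-∷ʳ : {A : Set} (xs : List A) (x : A) → last (xs ∷ʳ x) ≡ just x
last-∷ʳ []           x = refl
last-∷ʳ (y ∷ [])     x = refl
last-∷ʳ (y ∷ z ∷ xs) x = last-∷ʳ (z ∷ xs) x

module _ {A : Set} {R : A → A → Set} where

  Linked-∷ʳ⁺ : ∀ {xs x} → Linked R xs → Connected R (last xs) (just x) → Linked R (xs ∷ʳ x)
  Linked-∷ʳ⁺ xs-linked last-to-x = Linked.++⁺ xs-linked last-to-x [-]

  Linked-∷ʳ⁻ : ∀ xs {x} → Linked R (xs ∷ʳ x) → Linked R xs × Connected R (last xs) (just x)
  Linked-∷ʳ⁻ []           _                = [] , nothing-just
  Linked-∷ʳ⁻ (y ∷ [])     (r ∷ [-])        = [-] , just r
  Linked-∷ʳ⁻ (y ∷ z ∷ xs) (r ∷ rest) with Linked-∷ʳ⁻ (z ∷ xs) rest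
  ... | rest-linked , last-to-x = r ∷ rest-linked , last-to-x

last-divides-all : ∀ xs {y} → Linked (λ a b → b ∣ a) (xs ∷ʳ y) → All (y ∣_) (xs ∷ʳ y)
last-divides-all []           _             = ∣-refl ∷ []
last-divides-all (x ∷ [])     (x∣ ∷ [-])    = x∣ ∷ ∣-refl ∷ []
last-divides-all (x ∷ z ∷ xs) (z∣x ∷ rest) with last-divides-all (z ∷ xs) rest
... | y∣z ∷ y∣rest = ∣-trans y∣z z∣x ∷ y∣z ∷ y∣rest

sublists-bounded : ∀ N {l} → l ∈ sublists (downFrom1 N) → All (_≤ N) l
sublists-bounded zero    (here refl) = []
sublists-bounded (suc N) {l} l∈ with ∈-++⁻ (map (suc N ∷_) (sublists (downFrom1 N))) l∈
... | inj₂ l∈rest = All.map m≤n⇒m≤1+n (sublists-bounded N l∈rest)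
... | inj₁ l∈with-N with ∈-map⁻ (suc N ∷_) l∈with-N
...   | l′ , l′∈ , refl = ≤-refl ∷ All.map m≤n⇒m≤1+n (sublists-bounded N l′∈)

sublists-unique : ∀ N → Unique (sublists (downFrom1 N))
sublists-unique zero    = [] ∷ []
sublists-unique (suc N) =
  Unique.++⁺ (Unique.map⁺ ∷-injectiveʳ (sublists-unique N)) (sublists-unique N) disjoint
  where
  disjoint : ∀ {l} → ¬ (l ∈ map (suc N ∷_) (sublists (downFrom1 N)) × l ∈ sublists (downFrom1 N))
  disjoint (l∈with-N , l∈rest) with ∈-map⁻ (suc N ∷_) l∈with-N
  ... | _ , _ , refl with sublists-bounded N l∈rest
  ... | 1+N≤N ∷ _ = <-irrefl refl 1+N≤N

below-head : ∀ {x l} → Linked (λ a b → b < a) (x ∷ l) → All (_< x) l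
below-head decreasing with Linked.Linked⇒AllPairs (λ b<a c<b → <-trans c<b b<a) decreasing
... | below ∷ _ = below

sublists-complete : ∀ N {l} → Linked (λ x y → y < x) l → All (0 <_) l → All (_≤ N) l →
  l ∈ sublists (downFrom1 N)
sublists-complete zero    {[]}    _ _ _ = here refl
sublists-complete zero    {x ∷ l} _ (0<x ∷ _) (x≤0 ∷ _) = contradiction (<-≤-trans 0<x x≤0) (<-irrefl refl)
sublists-complete (suc N) {[]}    _ _ _ =
  ∈-++⁺ʳ (map (suc N ∷_) (sublists (downFrom1 N))) (sublists-complete N [] [] [])
sublists-complete (suc N) {x ∷ l} decreasing (0<x ∷ positive) (x≤1+N ∷ _) with x ≟ suc N
... | yes refl = ∈-++⁺ˡ (∈-map⁺ (suc N ∷_)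
      (sublists-complete N (Linked.tail decreasing) positive (All.map ≤-pred (below-head decreasing))))
... | no x≢1+N = ∈-++⁺ʳ (map (suc N ∷_) (sublists (downFrom1 N)))
      (sublists-complete N decreasing (0<x ∷ positive)
        (x≤N ∷ All.map (λ y<x → <⇒≤ (<-≤-trans y<x x≤N)) (below-head decreasing)))
  where
  x≤N : x ≤ N
  x≤N = ≤-pred (≤∧≢⇒< x≤1+N x≢1+N)

entries-≤-sum : ∀ l → All (_≤ sum l) l
entries-≤-sum []      = []
entries-≤-sum (x ∷ l) = m≤m+n x (sum l) ∷ All.map (λ y≤ → ≤-trans y≤ (m≤n+m (sum l) x)) (entries-≤-sum l)

module Counting (q : ℕ) where

  Parts : ℕ → List (List ℕ)
  Parts n = filter (isSCPartition? q n) (sublists (downFrom1 n))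

  count : {X : List ℕ → Set} → Decidable X → ℕ → ℕ
  count X? n = length (filter X? (Parts n))

  private
    ∈-counted⁻ : ∀ {X : List ℕ → Set} (X? : Decidable X) {n l} →
      l ∈ filter X? (Parts n) → IsSCPartition q n l × X l
    ∈-counted⁻ X? {n} l∈ with ∈-filter⁻ X? l∈
    ... | l∈Parts , x = proj₂ (∈-filter⁻ (isSCPartition? q n) {xs = sublists (downFrom1 n)} l∈Parts) , x

    ∈-counted⁺ : ∀ {X : List ℕ → Set} (X? : Decidable X) {n l} →
      IsSCPartition q n l → X l → l ∈ filter X? (Parts n)
    ∈-counted⁺ X? {n} {l} partition@(parts , chain , total) x =
      ∈-filter⁺ X? (∈-filter⁺ (isSCPartition? q n) candidate partition) x
      where
      candidate : l ∈ sublists (downFrom1 n)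
      candidate = sublists-complete n (Linked.map proj₁ chain) (All.map proj₁ parts)
                    (subst (λ m → All (_≤ m) l) total (entries-≤-sum l))

    counted-unique : ∀ {X : List ℕ → Set} (X? : Decidable X) n → Unique (filter X? (Parts n))
    counted-unique X? n = Unique.filter⁺ X? (Unique.filter⁺ (isSCPartition? q n) (sublists-unique n))

  module _ {X Y : List ℕ → Set} (X? : Decidable X) (Y? : Decidable Y) {a b : ℕ} where

    count-≤ : (f : List ℕ → List ℕ) → (∀ {l l′} → f l ≡ f l′ → l ≡ l′) →
      (∀ {l} → IsSCPartition q a l → X l → IsSCPartition q b (f l) × Y (f l)) →
      count X? a ≤ count Y? b
    count-≤ f f-injective maps-into = length-injection f f-injective (counted-unique X? a) λ l∈ →
      let (partition , x) = ∈-counted⁻ X? l∈ ; (partition′ , y) = maps-into partition x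
      in ∈-counted⁺ Y? partition′ y

    count-≡ : (f : List ℕ → List ℕ) → (∀ {l l′} → f l ≡ f l′ → l ≡ l′) →
      (∀ {l} → IsSCPartition q a l → X l → IsSCPartition q b (f l) × Y (f l)) →
      (∀ {l} → IsSCPartition q b l → Y l → ∃ λ l′ → (IsSCPartition q a l′ × X l′) × f l′ ≡ l) →
      count X? a ≡ count Y? b
    count-≡ f f-injective maps-into onto = ≤-antisym (count-≤ f f-injective maps-into)
      (length-surjection f (counted-unique Y? b) λ l∈ →
        let (partition , y) = ∈-counted⁻ Y? l∈ ; (l′ , (partition′ , x) , fl′≡l) = onto partition y
        in l′ , ∈-counted⁺ X? partition′ x , fl′≡l)

  count-mono : ∀ {X Y : List ℕ → Set} (X? : Decidable X) (Y? : Decidable Y) n →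
    (∀ {l} → IsSCPartition q n l → X l → Y l) → count X? n ≤ count Y? n
  count-mono X? Y? n X⇒Y =
    count-≤ X? Y? (λ l → l) (λ l≡l′ → l≡l′) λ partition x → partition , X⇒Y partition x

  count-cong : ∀ {X Y : List ℕ → Set} (X? : Decidable X) (Y? : Decidable Y) n →
    (∀ {l} → IsSCPartition q n l → X l → Y l) → (∀ {l} → IsSCPartition q n l → Y l → X l) →
    count X? n ≡ count Y? n
  count-cong X? Y? n X⇒Y Y⇒X = ≤-antisym (count-mono X? Y? n X⇒Y) (count-mono Y? X? n Y⇒X)

  count-none : ∀ {X : List ℕ → Set} (X? : Decidable X) n →
    (∀ {l} → IsSCPartition q n l → ¬ X l) → count X? n ≡ 0
  count-none X? n never = n≤0⇒n≡0 (length-⊆ {ys = []} (counted-unique X? n) λ l∈ →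
    let (partition , x) = ∈-counted⁻ X? l∈ in contradiction x (never partition))

  count-≤-W : ∀ {X : List ℕ → Set} (X? : Decidable X) n → count X? n ≤ W q n
  count-≤-W X? n = length-filter X? (Parts n)

  any? : Decidable (λ (l : List ℕ) → ⊤)
  any? _ = yes tt

  count-any : ∀ n → count any? n ≡ W q n
  count-any n = cong length (filter-all any? {xs = Parts n} (All.tabulate (λ _ → tt)))

  count-split : ∀ {X : List ℕ → Set} (X? : Decidable X) n →
    W q n ≡ count X? n + count (λ l → ¬? (X? l)) n
  count-split X? n = length-filter-¬ X? (Parts n)

  count-⊎ : ∀ {X Y : List ℕ → Set} (X? : Decidable X) (Y? : Decidable Y) n →
    count (λ l → X? l ⊎-dec Y? l) n + count (λ l → X? l ×-dec Y? l) n ≡ count X? n + count Y? n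
  count-⊎ X? Y? n = length-filter-⊎ X? Y? (Parts n)

sum-scaled : ∀ c l → sum (map (c *_) l) ≡ c * sum l
sum-scaled c []      = sym (*-zeroʳ c)
sum-scaled c (x ∷ l) = trans (cong (c * x +_) (sum-scaled c l)) (sym (*-distribˡ-+ c x (sum l)))

∣-sum : ∀ {d l} → All (d ∣_) l → d ∣ sum l
∣-sum []             = divides 0 refl
∣-sum (d∣x ∷ d∣rest) = ∣m∣n⇒∣m+n d∣x (∣-sum d∣rest)

-- Multiplying all parts by c: when c·y is a part exactly when y is, this turns the
-- partitions of m into the partitions of c·m all of whose parts are multiples of c.
module Scaling (q c : ℕ) {{_ : NonZero c}}
  (scale-part : ∀ {y} → IsPart q y → IsPart q (c * y))
  (unscale-part : ∀ {y} → IsPart q (c * y) → IsPart q y) where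

  open Counting q

  scale : List ℕ → List ℕ
  scale = map (c *_)

  scale-injective : ∀ {l l′} → scale l ≡ scale l′ → l ≡ l′
  scale-injective = map-injective (*-cancelˡ-≡ _ _ c)

  scale⁺ : ∀ {m l} → IsSCPartition q m l → IsSCPartition q (c * m) (scale l)
  scale⁺ {m} {l} (parts , chain , total) =
    All.map⁺ (All.map scale-part parts) ,
    Linked.map⁺ (Linked.map (λ (y<x , y∣x) → *-monoʳ-< c y<x , *-monoʳ-∣ c y∣x) chain) ,
    trans (sum-scaled c l) (cong (c *_) total)

  scale⁻ : ∀ {m l} → IsSCPartition q (c * m) (scale l) → IsSCPartition q m l
  scale⁻ {m} {l} (parts , chain , total) =
    All.map unscale-part (All.map⁻ parts) ,
    Linked.map (λ (cy<cx , cy∣cx) → *-cancelˡ-< c _ _ cy<cx , *-cancelˡ-∣ c cy∣cx) (Linked.map⁻ chain) ,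
    *-cancelˡ-≡ (sum l) m c (trans (sym (sum-scaled c l)) total)

  scaled-divisible : ∀ l → All (c ∣_) (scale l)
  scaled-divisible l = All.map⁺ (All.tabulate (λ {x} _ → m∣m*n x))

  divisible-scaled : ∀ {l} → All (c ∣_) l → ∃ λ l′ → scale l′ ≡ l
  divisible-scaled []                        = [] , refl
  divisible-scaled (divides y refl ∷ c∣rest) with divisible-scaled c∣rest
  ... | l′ , refl = y ∷ l′ , cong (_∷ scale l′) (*-comm c y)

  count-scaled : ∀ {X Y : List ℕ → Set} (X? : Decidable X) (Y? : Decidable Y) m →
    (∀ {l} → Y l → All (c ∣_) l) → (∀ {l} → X l → Y (scale l)) → (∀ {l} → Y (scale l) → X l) →
    count Y? (c * m) ≡ count X? m
  count-scaled {Y = Y} X? Y? m Y⇒divisible X⇒Y Y⇒X = sym (count-≡ X? Y? scale scale-injective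
    (λ partition x → scale⁺ partition , X⇒Y x)
    λ partition y → let (l′ , scaled) = divisible-scaled (Y⇒divisible y) in
      l′ , (scale⁻ (subst (IsSCPartition q (c * m)) (sym scaled) partition) ,
            Y⇒X (subst Y (sym scaled) y)) , scaled)

next-block-double : ∀ q c → 2 * (q * c + q) ≡ q * suc (2 * c) + q
next-block-double = solve-∀

odd-multiple : ∀ q v → q * suc (2 * v) ≡ 2 * (q * v) + q
odd-multiple = solve-∀

data Parity : ℕ → Set where
  even : ∀ j → Parity (2 * j)
  odd  : ∀ j → Parity (suc (2 * j))

2*suc : ∀ j → 2 * suc j ≡ suc (suc (2 * j))
2*suc j = cong suc (+-suc j (j + 0))

parity : ∀ n → Parity n
parity zero = even 0
parity (suc n) with parity n
... | even j = odd j
... | odd j  = subst Parity (2*suc j) (even (suc j))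

2∤odd : ∀ j → ¬ 2 ∣ suc (2 * j)
2∤odd j (divides k 1+2j≡k*2) = even≢odd k j (trans (*-comm 2 k) (sym 1+2j≡k*2))

-- From here on q > 1 is odd.  Then 2 and q are coprime, which lets both scalings
-- (by 2 and by q) preserve and reflect parts.
module OddModulus (q : ℕ) (1<q : 1 < q) (q-odd : ¬ 2 ∣ q) where

  0<q : 0 < q
  0<q = <-trans z<s 1<q

  instance
    q-nonzero : NonZero q
    q-nonzero = >-nonZero 0<q

  2-coprime-q : Coprime 2 q
  2-coprime-q {zero}              (divides k 2≡k*0 , _) = contradiction (trans 2≡k*0 (*-zeroʳ k)) λ ()
  2-coprime-q {suc zero}          _                     = refl
  2-coprime-q {suc (suc zero)}    (_ , 2∣q)             = contradiction 2∣q q-odd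
  2-coprime-q {suc (suc (suc d))} (3+d∣2 , _)           = contradiction (∣⇒≤ 3+d∣2) λ { (s≤s (s≤s ())) }

  2∣q*⇒2∣ : ∀ {y} → 2 ∣ q * y → 2 ∣ y
  2∣q*⇒2∣ = coprime-divisor 2-coprime-q

  q∣2*⇒q∣ : ∀ {y} → q ∣ 2 * y → q ∣ y
  q∣2*⇒q∣ = coprime-divisor (Coprimality.sym 2-coprime-q)

  2∤q^ : ∀ b → ¬ 2 ∣ q ^ b
  2∤q^ zero    2∣1   = contradiction (∣1⇒≡1 2∣1) λ ()
  2∤q^ (suc b) 2∣q^b = 2∤q^ b (2∣q*⇒2∣ 2∣q^b)

  q∤2^ : ∀ a → ¬ q ∣ 2 ^ a
  q∤2^ zero    q∣1    = contradiction (∣1⇒≡1 q∣1) (>⇒≢ 1<q)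
  q∤2^ (suc a) q∣2^a  = q∤2^ a (q∣2*⇒q∣ q∣2^a)

  q∤-small : ∀ {d} → 0 < d → d < q → ¬ q ∣ d
  q∤-small 0<d d<q q∣d = <⇒≱ d<q (∣⇒≤ {{>-nonZero 0<d}} q∣d)

  2<q : 2 < q
  2<q = ≤∧≢⇒< 1<q λ { refl → q-odd ∣-refl }

  q∤1 : ¬ q ∣ 1
  q∤1 = q∤-small z<s 1<q

  q∤-shift : ∀ {n d} → 0 < d → d < q → q ∣ n → ¬ q ∣ d + n
  q∤-shift {n} {d} 0<d d<q q∣n q∣d+n =
    q∤-small 0<d d<q (∣m+n∣m⇒∣n (subst (q ∣_) (+-comm d n) q∣d+n) q∣n)

  q∤-unshift : ∀ {n d} → 0 < d → d < q → q ∣ d + n → ¬ q ∣ n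
  q∤-unshift 0<d d<q q∣d+n q∣n = q∤-shift 0<d d<q q∣n q∣d+n

  q∤suc : ∀ {n} → q ∣ n → ¬ q ∣ suc n
  q∤suc = q∤-shift z<s 1<q

  q∤pred : ∀ {n} → q ∣ suc n → ¬ q ∣ n
  q∤pred = q∤-unshift z<s 1<q

  q∤pred² : ∀ {n} → q ∣ suc (suc n) → ¬ q ∣ n
  q∤pred² = q∤-unshift z<s 2<q

  quotient-by-q : ∀ {n} → q ∣ n → ∃ λ m → n ≡ q * m
  quotient-by-q (divides m n≡m*q) = m , trans n≡m*q (*-comm m q)

  private
    positive-factor : ∀ c {y} → 0 < c * y → 0 < y
    positive-factor c {zero}  0<c*0 = contradiction (subst (0 <_) (*-zeroʳ c) 0<c*0) (<-irrefl refl)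
    positive-factor c {suc y} _     = z<s

  double-part : ∀ {y} → IsPart q y → IsPart q (2 * y)
  double-part (0<y , a , b , 2^a*q^b≡y) =
    *-monoʳ-< 2 0<y , suc a , b , trans (*-assoc 2 (2 ^ a) (q ^ b)) (cong (2 *_) 2^a*q^b≡y)

  halve-part : ∀ {y} → IsPart q (2 * y) → IsPart q y
  halve-part {y} (0<2y , zero , b , q^b≡2y) =
    contradiction (divides y (trans (sym (*-identityˡ (q ^ b))) (trans q^b≡2y (*-comm 2 y)))) (2∤q^ b)
  halve-part {y} (0<2y , suc a , b , 2^[1+a]*q^b≡2y) =
    positive-factor 2 0<2y , a , b , *-cancelˡ-≡ _ y 2 (trans (sym (*-assoc 2 (2 ^ a) (q ^ b))) 2^[1+a]*q^b≡2y)

  times-q-part : ∀ {y} → IsPart q y → IsPart q (q * y)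
  times-q-part {y} (0<y , a , b , 2^a*q^b≡y) =
    subst (_< q * y) (*-zeroʳ q) (*-monoʳ-< q 0<y) , a , suc b ,
    trans (*-left-swap (2 ^ a) q (q ^ b)) (cong (q *_) 2^a*q^b≡y)

  divide-q-part : ∀ {y} → IsPart q (q * y) → IsPart q y
  divide-q-part {y} (0<qy , a , zero , 2^a≡qy) =
    contradiction (divides y (trans (sym (*-identityʳ (2 ^ a))) (trans 2^a≡qy (*-comm q y)))) (q∤2^ a)
  divide-q-part {y} (0<qy , a , suc b , 2^a*q^[1+b]≡qy) =
    positive-factor q 0<qy , a , b , *-cancelˡ-≡ _ y q (trans (sym (*-left-swap (2 ^ a) q (q ^ b))) 2^a*q^[1+b]≡qy)

module Recurrences (q : ℕ) (1<q : 1 < q) (q-odd : ¬ 2 ∣ q) where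

  open OddModulus q 1<q q-odd public
  open Counting q

  private
    module ByTwo = Scaling q 2 double-part halve-part
    module ByQ   = Scaling q q times-q-part divide-q-part

  AllEven AllMultQ : List ℕ → Set
  AllEven  = All (2 ∣_)
  AllMultQ = All (q ∣_)

  allEven? : Decidable AllEven
  allEven? = all? (2 ∣?_)

  allMultQ? : Decidable AllMultQ
  allMultQ? = all? (q ∣?_)

  evenOrMultQ? : Decidable (λ l → AllEven l ⊎ AllMultQ l)
  evenOrMultQ? l = allEven? l ⊎-dec allMultQ? l

  evenAndMultQ? : Decidable (λ l → AllEven l × AllMultQ l)
  evenAndMultQ? l = allEven? l ×-dec allMultQ? l

  -- E, Q, B count the partitions of n with all parts even, all parts multiples of q,
  -- or both; A counts those with all parts even or all multiples of q, which (see
  -- count-no-one) are exactly the partitions that do not end in the part 1.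
  E Q B A : ℕ → ℕ
  E = count allEven?
  Q = count allMultQ?
  B = count evenAndMultQ?
  A = count evenOrMultQ?

  EndsInOne : List ℕ → Set
  EndsInOne l = last l ≡ just 1

  endsInOne? : Decidable EndsInOne
  endsInOne? l = ≡-dec _≟_ (last l) (just 1)

  part-≢1 : ∀ {y} → IsPart q y → y ≢ 1 → 2 ∣ y ⊎ q ∣ y
  part-≢1 (_ , suc a , b     , refl) _   = inj₁ (∣m⇒∣m*n (q ^ b) (m∣m*n (2 ^ a)))
  part-≢1 (_ , zero  , suc b , refl) _   = inj₂ (∣n⇒∣m*n 1 (m∣m*n (q ^ b)))
  part-≢1 (_ , zero  , zero  , refl) y≢1 = contradiction refl y≢1

  -- The last (smallest) part divides all others, so a partition avoids the part 1
  -- exactly when all its parts are even or all are multiples of q.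
  count-no-one : ∀ n → count (λ l → ¬? (endsInOne? l)) n ≡ A n
  count-no-one n = count-cong (λ l → ¬? (endsInOne? l)) evenOrMultQ? n to from
    where
    to : ∀ {l} → IsSCPartition q n l → ¬ EndsInOne l → AllEven l ⊎ AllMultQ l
    to {l} (parts , chain , _) no-one with initLast l
    ... | []       = inj₁ []
    ... | ys ∷ʳ′ y with part-≢1 (proj₂ (All.∷ʳ⁻ parts)) (λ { refl → no-one (last-∷ʳ ys 1) })
    ...   | inj₁ 2∣y = inj₁ (All.map (∣-trans 2∣y) (last-divides-all ys (Linked.map proj₂ chain)))
    ...   | inj₂ q∣y = inj₂ (All.map (∣-trans q∣y) (last-divides-all ys (Linked.map proj₂ chain)))

    from : ∀ {l} → IsSCPartition q n l → AllEven l ⊎ AllMultQ l → ¬ EndsInOne l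
    from {l} _ divisible ends-in-one with initLast l
    from _ _ () | []
    from _ divisible ends-in-one | ys ∷ʳ′ y with just-injective (trans (sym (last-∷ʳ ys y)) ends-in-one)
    from _ (inj₁ evens) _ | ys ∷ʳ′ _ | refl = contradiction (∣1⇒≡1 (proj₂ (All.∷ʳ⁻ evens))) λ ()
    from _ (inj₂ mults) _ | ys ∷ʳ′ _ | refl = q∤1 (proj₂ (All.∷ʳ⁻ mults))

  -- Removing a final part 1 is a bijection from the partitions of n+1 ending in 1
  -- onto the partitions of n not ending in 1.
  count-ends-in-one : ∀ n → count endsInOne? (suc n) ≡ count (λ l → ¬? (endsInOne? l)) n
  count-ends-in-one n = sym (count-≡ (λ l → ¬? (endsInOne? l)) endsInOne? (_∷ʳ 1) (∷ʳ-injectiveˡ _ _)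
    append-one remove-one)
    where
    append-one : ∀ {l} → IsSCPartition q n l → ¬ EndsInOne l →
      IsSCPartition q (suc n) (l ∷ʳ 1) × EndsInOne (l ∷ʳ 1)
    append-one {l} (parts , chain , total) no-one =
      (All.∷ʳ⁺ parts (z<s , 0 , 0 , refl) , Linked-∷ʳ⁺ chain (step-to-one l parts no-one) ,
       trans (sum-++ l [ 1 ]) (trans (+-comm (sum l) 1) (cong suc total))) ,
      last-∷ʳ l 1
      where
      step-to-one : ∀ l → All (IsPart q) l → ¬ EndsInOne l → Connected ChainStep (last l) (just 1)
      step-to-one l parts no-one with initLast l
      ... | []       = nothing-just
      ... | ys ∷ʳ′ y rewrite last-∷ʳ ys y =
        just (≤∧≢⇒< (proj₁ (proj₂ (All.∷ʳ⁻ parts))) (λ 1≡y → no-one (cong just (sym 1≡y))) ,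
              divides y (sym (*-identityʳ y)))

    remove-one : ∀ {l} → IsSCPartition q (suc n) l → EndsInOne l →
      ∃ λ l′ → (IsSCPartition q n l′ × ¬ EndsInOne l′) × l′ ∷ʳ 1 ≡ l
    remove-one {l} (parts , chain , total) ends-in-one with initLast l
    remove-one _ () | []
    remove-one (parts , chain , total) ends-in-one | ys ∷ʳ′ y
      with refl ← just-injective (trans (sym (last-∷ʳ ys y)) ends-in-one)
      with ys-chain , last-step ← Linked-∷ʳ⁻ ys chain =
      ys , ((proj₁ (All.∷ʳ⁻ parts) , ys-chain ,
             suc-injective (trans (+-comm 1 (sum ys)) (trans (sym (sum-++ ys [ 1 ])) total))) ,
            λ ys-ends-in-one → no-step ys-ends-in-one last-step) ,
      refl
      where
      no-step : ∀ {m} → m ≡ just 1 → ¬ Connected ChainStep m (just 1)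
      no-step refl (just (1<1 , _)) = <-irrefl refl 1<1

  -- Halving, resp. dividing by q, identifies these families with all partitions of
  -- m (E 2m = Q qm = W m) and with the q-multiple partitions of m (B 2m = Q m).
  E-double : ∀ m → E (2 * m) ≡ W q m
  E-double m = trans (ByTwo.count-scaled any? allEven? m (λ evens → evens)
                        (λ {l} _ → ByTwo.scaled-divisible l) (λ _ → tt))
                     (count-any m)

  Q-times-q : ∀ m → Q (q * m) ≡ W q m
  Q-times-q m = trans (ByQ.count-scaled any? allMultQ? m (λ mults → mults)
                         (λ {l} _ → ByQ.scaled-divisible l) (λ _ → tt))
                      (count-any m)

  B-double : ∀ m → B (2 * m) ≡ Q m
  B-double m = ByTwo.count-scaled allMultQ? evenAndMultQ? m proj₁
    (λ {l} mults → ByTwo.scaled-divisible l , All.map⁺ (All.map (∣n⇒∣m*n 2) mults))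
    (λ (_ , mults) → All.map q∣2*⇒q∣ (All.map⁻ mults))

  -- Sums of even parts are even, sums of multiples of q are multiples of q.
  E-odd : ∀ {n} → ¬ 2 ∣ n → E n ≡ 0
  E-odd {n} 2∤n = count-none allEven? n λ (_ , _ , total) evens → 2∤n (subst (2 ∣_) total (∣-sum evens))

  Q-nondivisible : ∀ {n} → ¬ q ∣ n → Q n ≡ 0
  Q-nondivisible {n} q∤n = count-none allMultQ? n λ (_ , _ , total) mults → q∤n (subst (q ∣_) total (∣-sum mults))

  -- A partition counted by B is counted by both E and Q.
  B-empty : ∀ {n} → E n ≡ 0 ⊎ Q n ≡ 0 → B n ≡ 0
  B-empty {n} (inj₁ E≡0) = n≤0⇒n≡0 (subst (B n ≤_) E≡0 (count-mono evenAndMultQ? allEven? n (λ _ → proj₁)))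
  B-empty {n} (inj₂ Q≡0) = n≤0⇒n≡0 (subst (B n ≤_) Q≡0 (count-mono evenAndMultQ? allMultQ? n (λ _ → proj₂)))

  A≡E+Q : ∀ n → E n ≡ 0 ⊎ Q n ≡ 0 → A n ≡ E n + Q n
  A≡E+Q n one-empty = begin
    A n         ≡⟨ sym (+-identityʳ (A n)) ⟩
    A n + 0     ≡⟨ cong (A n +_) (sym (B-empty {n} one-empty)) ⟩
    A n + B n   ≡⟨ count-⊎ allEven? allMultQ? n ⟩
    E n + Q n   ∎
    where open ≡-Reasoning

  W-suc : ∀ n → W q (suc n) ≡ A (suc n) + A n
  W-suc n = begin
    W q (suc n)                                                  ≡⟨ count-split endsInOne? (suc n) ⟩
    count endsInOne? (suc n) + count (λ l → ¬? (endsInOne? l)) (suc n)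
      ≡⟨ cong₂ _+_ (trans (count-ends-in-one n) (count-no-one n)) (count-no-one (suc n)) ⟩
    A n + A (suc n)                                              ≡⟨ +-comm (A n) (A (suc n)) ⟩
    A (suc n) + A n                                              ∎
    where open ≡-Reasoning

  A-coprime : ∀ {n} → ¬ 2 ∣ n → ¬ q ∣ n → A n ≡ 0
  A-coprime {n} 2∤n q∤n = trans (A≡E+Q n (inj₁ (E-odd 2∤n))) (cong₂ _+_ (E-odd 2∤n) (Q-nondivisible q∤n))

  A-double : ∀ m → ¬ q ∣ 2 * m → A (2 * m) ≡ W q m
  A-double m q∤2m = trans (A≡E+Q (2 * m) (inj₂ (Q-nondivisible q∤2m)))
    (trans (cong₂ _+_ (E-double m) (Q-nondivisible q∤2m)) (+-identityʳ (W q m)))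

  A-times-q : ∀ m → ¬ 2 ∣ m → A (q * m) ≡ W q m
  A-times-q m 2∤m = trans (A≡E+Q (q * m) (inj₁ E≡0)) (cong₂ _+_ E≡0 (Q-times-q m))
    where
    E≡0 : E (q * m) ≡ 0
    E≡0 = E-odd (λ 2∣qm → 2∤m (2∣q*⇒2∣ 2∣qm))

  A-double-times-q : ∀ m → A (2 * (q * m)) + W q m ≡ W q (q * m) + W q (2 * m)
  A-double-times-q m = begin
    A (2 * (q * m)) + W q m            ≡⟨ cong (A (2 * (q * m)) +_) (sym (trans (B-double (q * m)) (Q-times-q m))) ⟩
    A (2 * (q * m)) + B (2 * (q * m))  ≡⟨ count-⊎ allEven? allMultQ? (2 * (q * m)) ⟩
    E (2 * (q * m)) + Q (2 * (q * m))  ≡⟨ cong₂ _+_ (E-double (q * m)) (cong Q (*-left-swap 2 q m)) ⟩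
    W q (q * m) + Q (q * (2 * m))      ≡⟨ cong (W q (q * m) +_) (Q-times-q (2 * m)) ⟩
    W q (q * m) + W q (2 * m)          ∎
    where open ≡-Reasoning

  -- Doubling the parts embeds the partitions of m into those counted by A 2m.
  W≤A-double : ∀ m → W q m ≤ A (2 * m)
  W≤A-double m = subst (_≤ A (2 * m)) (E-double m) (count-mono allEven? evenOrMultQ? (2 * m) (λ _ → inj₁))

  A≤W : ∀ n → A n ≤ W q n
  A≤W = count-≤-W evenOrMultQ?

module Inequalities (q : ℕ) (1<q : 1 < q) (q-odd : ¬ 2 ∣ q) where

  open Recurrences q 1<q q-odd public

  -- By W-suc, comparing consecutive values of W amounts to comparing A two apart.
  W-step-down : ∀ n → A (2 + n) ≤ A n → W q (2 + n) ≤ W q (1 + n)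
  W-step-down n A-down = begin
    W q (2 + n)         ≡⟨ W-suc (suc n) ⟩
    A (2 + n) + A (1 + n) ≤⟨ +-monoˡ-≤ (A (1 + n)) A-down ⟩
    A n + A (1 + n)     ≡⟨ +-comm (A n) (A (1 + n)) ⟩
    A (1 + n) + A n     ≡⟨ sym (W-suc n) ⟩
    W q (1 + n)         ∎
    where open ≤-Reasoning

  W-step-up : ∀ n x → A n ≤ A (2 + n) + x → W q (1 + n) ≤ W q (2 + n) + x
  W-step-up n x A-up = begin
    W q (1 + n)                 ≡⟨ W-suc n ⟩
    A (1 + n) + A n             ≤⟨ +-monoʳ-≤ (A (1 + n)) A-up ⟩
    A (1 + n) + (A (2 + n) + x) ≡⟨ +-left-swap (A (1 + n)) (A (2 + n)) x ⟩
    A (2 + n) + (A (1 + n) + x) ≡⟨ sym (+-assoc (A (2 + n)) (A (1 + n)) x) ⟩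
    A (2 + n) + A (1 + n) + x   ≡⟨ cong (_+ x) (sym (W-suc (suc n))) ⟩
    W q (2 + n) + x             ∎
    where open ≤-Reasoning

  -- W m ≤ W 2m and W m ≤ W (2m + 1), both through W m ≤ A 2m.
  W-double : ∀ m → W q m ≤ W q (2 * m)
  W-double m = ≤-trans (W≤A-double m) (A≤W (2 * m))

  W-double-suc : ∀ m → W q m ≤ W q (suc (2 * m))
  W-double-suc m = ≤-trans (W≤A-double m) (subst (A (2 * m) ≤_) (sym (W-suc (2 * m))) (m≤n+m (A (2 * m)) _))

  Antitone : ℕ → Set
  Antitone n = ¬ q ∣ suc n → W q (suc n) ≤ W q n

  -- For n + 2 = 2(j + 1): A 2(j + 1) = W (j + 1) ≤ W j ≤ A 2j by induction at j;
  -- for odd n + 2, A (n + 2) = 0.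
  W-antitone : ∀ n → Antitone n
  W-antitone = <-rec Antitone step
    where
    step : ∀ n → (∀ {m} → m < n → Antitone m) → Antitone n
    step zero _ q∤1 = begin
      W q 1     ≡⟨ W-suc 0 ⟩
      A 1 + A 0 ≡⟨ cong (_+ A 0) (A-coprime (2∤odd 0) q∤1) ⟩
      A 0       ≤⟨ A≤W 0 ⟩
      W q 0     ∎
      where open ≤-Reasoning
    step (suc n) antitone-below q∤2+n with parity n
    ... | odd j  = W-step-down (suc (2 * j)) (subst (_≤ A (suc (2 * j))) (sym A≡0) z≤n)
      where
      A≡0 : A (3 + 2 * j) ≡ 0
      A≡0 = A-coprime (subst (λ k → ¬ 2 ∣ suc k) (2*suc j) (2∤odd (suc j))) q∤2+n
    ... | even j = W-step-down (2 * j) (begin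
      A (2 + 2 * j)     ≡⟨ cong A (sym (2*suc j)) ⟩
      A (2 * suc j)     ≡⟨ A-double (suc j) q∤2[1+j] ⟩
      W q (suc j)       ≤⟨ antitone-below (s≤s (m≤m+n j _)) (λ q∣1+j → q∤2[1+j] (∣n⇒∣m*n 2 q∣1+j)) ⟩
      W q j             ≤⟨ W≤A-double j ⟩
      A (2 * j)         ∎)
      where
      open ≤-Reasoning
      q∤2[1+j] : ¬ q ∣ 2 * suc j
      q∤2[1+j] = subst (λ k → ¬ q ∣ k) (sym (2*suc j)) q∤2+n

  InBlock : ℕ → ℕ → Set
  InBlock c k = q * c ≤ k × k < q * c + q

  block-unique : ∀ {c d k} → InBlock c k → InBlock d k → c ≡ d
  block-unique {c} {d} (qc≤k , k<qc+q) (qd≤k , k<qd+q) = ≤-antisym (below qc≤k k<qd+q) (below qd≤k k<qc+q)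
    where
    below : ∀ {c d k} → q * c ≤ k → k < q * d + q → c ≤ d
    below {c} {d} qc≤k k<qd+q = ≤-pred (*-cancelˡ-< q c (suc d)
      (<-≤-trans (≤-<-trans qc≤k k<qd+q) (≤-reflexive (trans (+-comm (q * d) q) (sym (*-suc q d))))))

  block-of : ∀ k → ∃ λ c → InBlock c k
  block-of k = k / q , lower , upper
    where
    division : k ≡ k % q + k / q * q
    division = m≡m%n+[m/n]*n k q
    lower : q * (k / q) ≤ k
    lower = begin
      q * (k / q)         ≡⟨ *-comm q (k / q) ⟩
      k / q * q           ≤⟨ m≤n+m (k / q * q) (k % q) ⟩
      k % q + k / q * q   ≡⟨ sym division ⟩
      k                   ∎
      where open ≤-Reasoning
    upper : k < q * (k / q) + q
    upper = begin-strict
      k                   ≡⟨ division ⟩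
      k % q + k / q * q   <⟨ +-monoˡ-< (k / q * q) (m%n<n k q) ⟩
      q + k / q * q       ≡⟨ +-comm q (k / q * q) ⟩
      k / q * q + q       ≡⟨ cong (_+ q) (*-comm (k / q) q) ⟩
      q * (k / q) + q     ∎
      where open ≤-Reasoning

  multiple-in-block : ∀ {m d k} → k ≡ q * m + d → d < q → InBlock m k
  multiple-in-block {m} refl d<q = m≤m+n (q * m) _ , +-monoʳ-< (q * m) d<q

  block-double : ∀ {c′ c i} → InBlock c′ i → InBlock c (suc (2 * i)) → c ≡ 2 * c′ ⊎ c ≡ suc (2 * c′)
  block-double {c′} {c} {i} (qc′≤i , i<qc′+q) block with suc (2 * i) <? q * (2 * c′) + q
  ... | yes below = inj₁ (block-unique block (lower , below))
    where
    lower : q * (2 * c′) ≤ suc (2 * i)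
    lower = ≤-trans (≤-reflexive (*-left-swap q 2 c′)) (m≤n⇒m≤1+n (*-monoʳ-≤ 2 qc′≤i))
  ... | no ¬below = inj₂ (block-unique block (lower , upper))
    where
    lower : q * suc (2 * c′) ≤ suc (2 * i)
    lower = ≤-trans (≤-reflexive (trans (*-suc q (2 * c′)) (+-comm q _))) (≮⇒≥ ¬below)
    upper : suc (2 * i) < q * suc (2 * c′) + q
    upper = begin-strict
      suc (2 * i)                 <⟨ n<1+n _ ⟩
      2 + 2 * i                   ≡⟨ sym (2*suc i) ⟩
      2 * suc i                   ≤⟨ *-monoʳ-≤ 2 i<qc′+q ⟩
      2 * (q * c′ + q)            ≡⟨ next-block-double q c′ ⟩
      q * suc (2 * c′) + q        ∎
      where open ≤-Reasoning

  BlockBound : ℕ → Set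
  BlockBound k = ∀ c → InBlock c k → ¬ q ∣ suc k → W q k ≤ W q (suc k) + W q c

  -- Odd half of its inductive step: A (2i + 1) is 0, or W m when 2i + 1 = qm.
  A-odd-≤ : ∀ i c → InBlock c (2 + 2 * i) → A (suc (2 * i)) ≤ W q c
  A-odd-≤ i c block with q ∣? suc (2 * i)
  ... | no q∤1+2i = subst (_≤ W q c) (sym (A-coprime (2∤odd i) q∤1+2i)) z≤n
  ... | yes q∣1+2i with quotient-by-q q∣1+2i
  ...   | m , 1+2i≡qm = ≤-reflexive (begin
    A (suc (2 * i))  ≡⟨ cong A 1+2i≡qm ⟩
    A (q * m)        ≡⟨ A-times-q m (λ 2∣m → 2∤odd i (subst (2 ∣_) (sym 1+2i≡qm) (∣n⇒∣m*n q 2∣m))) ⟩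
    W q m            ≡⟨ cong (W q) (block-unique (multiple-in-block 2+2i≡qm+1 1<q) block) ⟩
    W q c            ∎)
    where
    open ≡-Reasoning
    2+2i≡qm+1 : 2 + 2 * i ≡ q * m + 1
    2+2i≡qm+1 = trans (cong suc 1+2i≡qm) (+-comm 1 (q * m))

  -- Even half, when i = qm: combine A (2qm) + W m = W (qm) + W (2m) with the block
  -- bound at qm.
  A-even-multiple-≤ : ∀ i m c → i ≡ q * m → BlockBound i → InBlock c (suc (2 * i)) →
    A (2 * i) ≤ W q (suc i) + W q c
  A-even-multiple-≤ .(q * m) m c refl bound-at-qm block = +-cancelʳ-≤ (W q m) _ _ (begin
    A (2 * (q * m)) + W q m                    ≡⟨ A-double-times-q m ⟩
    W q (q * m) + W q (2 * m)                  ≤⟨ +-monoˡ-≤ (W q (2 * m)) (bound-at-qm m qm-in-block q∤1+qm) ⟩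
    W q (suc (q * m)) + W q m + W q (2 * m)    ≡⟨ +-assoc (W q (suc (q * m))) (W q m) (W q (2 * m)) ⟩
    W q (suc (q * m)) + (W q m + W q (2 * m))  ≡⟨ cong (W q (suc (q * m)) +_) (+-comm (W q m) (W q (2 * m))) ⟩
    W q (suc (q * m)) + (W q (2 * m) + W q m)  ≡⟨ sym (+-assoc (W q (suc (q * m))) (W q (2 * m)) (W q m)) ⟩
    W q (suc (q * m)) + W q (2 * m) + W q m    ≡⟨ cong (λ d → W q (suc (q * m)) + W q d + W q m) 2m≡c ⟩
    W q (suc (q * m)) + W q c + W q m          ∎)
    where
    open ≤-Reasoning
    qm-in-block : InBlock m (q * m)
    qm-in-block = multiple-in-block (sym (+-identityʳ (q * m))) 0<q
    q∤1+qm : ¬ q ∣ suc (q * m)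
    q∤1+qm = q∤suc (m∣m*n m)
    2m≡c : 2 * m ≡ c
    2m≡c = block-unique (multiple-in-block (trans (cong suc (*-left-swap 2 q m)) (+-comm 1 _)) 1<q) block

  -- Even half of the inductive step.  If q ∤ i then A (2i) = W i, bounded by the block
  -- bound at i, whose block index c′ satisfies W c′ ≤ W c by block-double.
  A-even-≤ : ∀ i c → (∀ {k} → k < suc (2 * i) → BlockBound k) → InBlock c (suc (2 * i)) → ¬ q ∣ suc i →
    A (2 * i) ≤ W q (suc i) + W q c
  A-even-≤ i c bound-below block q∤1+i with q ∣? i
  ... | yes q∣i = A-even-multiple-≤ i (proj₁ (quotient-by-q q∣i)) c (proj₂ (quotient-by-q q∣i))
                    (bound-below (s≤s (m≤m+n i _))) block
  ... | no q∤i with block-of i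
  ...   | c′ , block′ = begin
    A (2 * i)              ≡⟨ A-double i (λ q∣2i → q∤i (q∣2*⇒q∣ q∣2i)) ⟩
    W q i                  ≤⟨ bound-below (s≤s (m≤m+n i _)) c′ block′ q∤1+i ⟩
    W q (suc i) + W q c′   ≤⟨ +-monoʳ-≤ (W q (suc i)) W-c′≤W-c ⟩
    W q (suc i) + W q c    ∎
    where
    open ≤-Reasoning
    W-c′≤W-c : W q c′ ≤ W q c
    W-c′≤W-c with block-double block′ block
    ... | inj₁ refl = W-double c′
    ... | inj₂ refl = W-double-suc c′

  -- Strong induction: W k = A k + A (k − 1) and W (k + 1) = A (k + 1) + A k, so it
  -- suffices to bound A (k − 1) by A (k + 1) + W c; this is A-odd-≤ or A-even-≤.
  W-block-bound : ∀ k → BlockBound k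
  W-block-bound = <-rec BlockBound step
    where
    step : ∀ k → (∀ {k′} → k′ < k → BlockBound k′) → BlockBound k
    step zero _ c block _
      with block-unique block (multiple-in-block (sym (trans (+-identityʳ (q * 0)) (*-zeroʳ q))) 0<q)
    ... | refl = m≤n+m (W q 0) (W q 1)
    step (suc k) bound-below c block q∤2+k with parity k
    ... | odd i  = W-step-up (suc (2 * i)) (W q c) (≤-trans (A-odd-≤ i c block) (m≤n+m (W q c) _))
    ... | even i = W-step-up (2 * i) (W q c)
      (subst (λ x → A (2 * i) ≤ x + W q c) (sym A-2+2i) (A-even-≤ i c bound-below block q∤1+i))
      where
      q∤2[1+i] : ¬ q ∣ 2 * suc i
      q∤2[1+i] = subst (λ x → ¬ q ∣ x) (sym (2*suc i)) q∤2+k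
      q∤1+i : ¬ q ∣ suc i
      q∤1+i q∣1+i = q∤2[1+i] (∣n⇒∣m*n 2 q∣1+i)
      A-2+2i : A (2 + 2 * i) ≡ W q (suc i)
      A-2+2i = trans (cong A (sym (2*suc i))) (A-double (suc i) q∤2[1+i])

  odd-multiple-block : ∀ {K V} → suc (2 * K) ≡ q * suc (2 * V) → InBlock V K
  odd-multiple-block {K} {V} 1+2K≡q[1+2V] = ≤-pred (*-cancelˡ-< 2 (q * V) (suc K) lower) , *-cancelˡ-< 2 K _ upper
    where
    1+2K≡2qV+q : suc (2 * K) ≡ 2 * (q * V) + q
    1+2K≡2qV+q = trans 1+2K≡q[1+2V] (odd-multiple q V)
    lower : 2 * (q * V) < 2 * suc K
    lower = begin-strict
      2 * (q * V)      <⟨ m<m+n (2 * (q * V)) 0<q ⟩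
      2 * (q * V) + q  ≡⟨ sym 1+2K≡2qV+q ⟩
      suc (2 * K)      <⟨ n<1+n _ ⟩
      suc (suc (2 * K)) ≡⟨ sym (2*suc K) ⟩
      2 * suc K        ∎
      where open ≤-Reasoning
    upper : 2 * K < 2 * (q * V + q)
    upper = begin-strict
      2 * K                 <⟨ n<1+n _ ⟩
      suc (2 * K)           ≡⟨ 1+2K≡2qV+q ⟩
      2 * (q * V) + q       ≤⟨ +-monoʳ-≤ (2 * (q * V)) (m≤n*m q 2) ⟩
      2 * (q * V) + 2 * q   ≡⟨ sym (*-distribˡ-+ 2 (q * V) q) ⟩
      2 * (q * V + q)       ∎
      where open ≤-Reasoning

  W-odd-≡ : ∀ j → ¬ q ∣ 2 * j → ¬ q ∣ suc (2 * j) → W q (suc (2 * j)) ≡ W q j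
  W-odd-≡ j q∤2j q∤1+2j = begin
    W q (suc (2 * j))            ≡⟨ W-suc (2 * j) ⟩
    A (suc (2 * j)) + A (2 * j)  ≡⟨ cong₂ _+_ (A-coprime (2∤odd j) q∤1+2j) (A-double j q∤2j) ⟩
    W q j                        ∎
    where open ≡-Reasoning

  W-even-≡ : ∀ j → ¬ q ∣ suc (2 * j) → ¬ q ∣ 2 * suc j → W q (2 * suc j) ≡ W q (suc j)
  W-even-≡ j q∤1+2j q∤2[1+j] = begin
    W q (2 * suc j)                     ≡⟨ cong (W q) (2*suc j) ⟩
    W q (2 + 2 * j)                     ≡⟨ W-suc (suc (2 * j)) ⟩
    A (2 + 2 * j) + A (suc (2 * j))     ≡⟨ cong₂ _+_ (cong A (sym (2*suc j))) (A-coprime (2∤odd j) q∤1+2j) ⟩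
    A (2 * suc j) + 0                   ≡⟨ +-identityʳ _ ⟩
    A (2 * suc j)                       ≡⟨ A-double (suc j) q∤2[1+j] ⟩
    W q (suc j)                         ∎
    where open ≡-Reasoning

  -- W (n − 1) ≤ W (n + 1) for every multiple n of q.
  Sandwich : ℕ → Set
  Sandwich P = q ∣ suc P → W q P ≤ W q (2 + P)

  -- Case 2K + 1 = q(2V + 1):  W 2K = W K ≤ W (K + 1) + W V ≤ W (K + 1) + W (2V + 1) = W (2K + 2).
  sandwich-even : ∀ K V → suc (2 * K) ≡ q * suc (2 * V) → W q (2 * K) ≤ W q (2 + 2 * K)
  sandwich-even zero V 1≡q[1+2V] = contradiction (subst (q ∣_) (sym 1≡q[1+2V]) (m∣m*n _)) q∤1
  sandwich-even K@(suc K′) V 1+2K≡q[1+2V] = begin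
    W q (2 * K)                        ≡⟨ W-even-≡ K′ q∤1+2K′ q∤2K ⟩
    W q K                              ≤⟨ W-block-bound K V (odd-multiple-block 1+2K≡q[1+2V]) q∤1+K ⟩
    W q (suc K) + W q V                ≤⟨ +-monoʳ-≤ (W q (suc K)) (W-double-suc V) ⟩
    W q (suc K) + W q (suc (2 * V))    ≡⟨ cong₂ _+_ (sym A-2+2K) (sym A-1+2K) ⟩
    A (2 + 2 * K) + A (suc (2 * K))    ≡⟨ sym (W-suc (suc (2 * K))) ⟩
    W q (2 + 2 * K)                    ∎
    where
    open ≤-Reasoning
    q∣1+2K : q ∣ suc (2 * K)
    q∣1+2K = subst (q ∣_) (sym 1+2K≡q[1+2V]) (m∣m*n _)
    q∤2K : ¬ q ∣ 2 * K
    q∤2K = q∤pred q∣1+2K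
    q∤1+2K′ : ¬ q ∣ suc (2 * K′)
    q∤1+2K′ = q∤pred² (subst (λ x → q ∣ suc x) (2*suc K′) q∣1+2K)
    q∤2[1+K] : ¬ q ∣ 2 * suc K
    q∤2[1+K] = subst (λ x → ¬ q ∣ x) (sym (2*suc K)) (q∤suc q∣1+2K)
    q∤1+K : ¬ q ∣ suc K
    q∤1+K q∣1+K = q∤2[1+K] (∣n⇒∣m*n 2 q∣1+K)
    A-2+2K : A (2 + 2 * K) ≡ W q (suc K)
    A-2+2K = trans (cong A (sym (2*suc K))) (A-double (suc K) q∤2[1+K])
    A-1+2K : A (suc (2 * K)) ≡ W q (suc (2 * V))
    A-1+2K = trans (cong A 1+2K≡q[1+2V]) (A-times-q (suc (2 * V)) (2∤odd V))

  -- Case P + 1 = 2qV, P = 2P′ + 1:  W P = W P′ ≤ W (P′ + 2) = W (qV + 1) ≤ W qV, and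
  -- W (P + 2) = A 2qV = W qV + W 2V − W V ≥ W P′ since W V ≤ W 2V.
  sandwich-odd : ∀ P′ V → suc P′ ≡ q * V → Sandwich P′ → W q (suc (2 * P′)) ≤ W q (3 + 2 * P′)
  sandwich-odd P′ V 1+P′≡qV sandwich-P′ = begin
    W q (suc (2 * P′))    ≡⟨ W-odd-≡ P′ (q∤pred² q∣2+2P′) (q∤pred q∣2+2P′) ⟩
    W q P′                ≤⟨ +-cancelʳ-≤ (W q V) (W q P′) (A (2 * (q * V))) W[P′]+W[V]≤ ⟩
    A (2 * (q * V))       ≡⟨ cong A 2qV≡2+2P′ ⟩
    A (2 + 2 * P′)        ≡⟨ sym (cong (_+ A (2 + 2 * P′)) A-3+2P′) ⟩
    A (3 + 2 * P′) + A (2 + 2 * P′) ≡⟨ sym (W-suc (2 + 2 * P′)) ⟩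
    W q (3 + 2 * P′)      ∎
    where
    open ≤-Reasoning
    q∣1+P′ : q ∣ suc P′
    q∣1+P′ = subst (q ∣_) (sym 1+P′≡qV) (m∣m*n V)
    2qV≡2+2P′ : 2 * (q * V) ≡ 2 + 2 * P′
    2qV≡2+2P′ = trans (cong (2 *_) (sym 1+P′≡qV)) (2*suc P′)
    q∣2+2P′ : q ∣ 2 + 2 * P′
    q∣2+2P′ = subst (q ∣_) 2qV≡2+2P′ (∣n⇒∣m*n 2 (m∣m*n V))
    A-3+2P′ : A (3 + 2 * P′) ≡ 0
    A-3+2P′ = A-coprime (subst (λ x → ¬ 2 ∣ suc x) (2*suc P′) (2∤odd (suc P′))) (q∤suc q∣2+2P′)
    W[P′]≤W[qV] : W q P′ ≤ W q (q * V)
    W[P′]≤W[qV] = begin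
      W q P′               ≤⟨ sandwich-P′ q∣1+P′ ⟩
      W q (2 + P′)         ≡⟨ cong (λ x → W q (suc x)) 1+P′≡qV ⟩
      W q (suc (q * V))    ≤⟨ W-antitone (q * V) (q∤suc (m∣m*n V)) ⟩
      W q (q * V)          ∎
    W[P′]+W[V]≤ : W q P′ + W q V ≤ A (2 * (q * V)) + W q V
    W[P′]+W[V]≤ = begin
      W q P′ + W q V                 ≤⟨ +-mono-≤ W[P′]≤W[qV] (W-double V) ⟩
      W q (q * V) + W q (2 * V)      ≡⟨ sym (A-double-times-q V) ⟩
      A (2 * (q * V)) + W q V        ∎

  W-sandwich : ∀ P → Sandwich P
  W-sandwich = <-rec Sandwich step
    where
    step : ∀ P → (∀ {P′} → P′ < P → Sandwich P′) → Sandwich P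
    step P sandwich-below q∣1+P with parity P
    ... | odd P′ with quotient-by-q (q∣2*⇒q∣ (subst (q ∣_) (sym (2*suc P′)) q∣1+P))
    ...   | V , 1+P′≡qV = sandwich-odd P′ V 1+P′≡qV (sandwich-below (s≤s (m≤m+n P′ _)))
    step P sandwich-below q∣1+P | even K with quotient-by-q q∣1+P
    ... | U , 1+2K≡qU with parity U
    ...   | odd V  = sandwich-even K V 1+2K≡qU
    ...   | even V = contradiction (subst (2 ∣_) (sym 1+2K≡qU) (∣n⇒∣m*n q (m∣m*n V))) (2∤odd K)

open import Data.Integer using (+_; _-_)

theorem5p3 : (q : ℕ) → 1 < q → ¬ (2 ∣ q) → (U : ℕ) →
    (W q (q * U + 1) ≤ W q (q * U)
      × Wℤ q ((+ (q * U)) - (+ 1)) ≤ W q (q * U + 1))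
    × ((r : ℕ) → r < q ∸ 1 → W q (q * U + r + 1) ≤ W q (q * U + r))
theorem5p3 q 1<q q-odd U =
  (subst (λ n → W q (n + 1) ≤ W q n) (+-identityʳ (q * U)) (decreasing 0 1<q) , sandwich (q * U) (m∣m*n U)) ,
  λ r r<q∸1 → decreasing r (≤-trans (s≤s r<q∸1) (≤-reflexive (suc-pred q)))
  where
  open Inequalities q 1<q q-odd

  decreasing : ∀ r → suc r < q → W q (q * U + r + 1) ≤ W q (q * U + r)
  decreasing r 1+r<q = subst (λ n → W q n ≤ W q (q * U + r)) (+-comm 1 (q * U + r))
    (W-antitone (q * U + r) (subst (λ n → ¬ q ∣ n) (cong suc (+-comm r (q * U))) (q∤-shift z<s 1+r<q (m∣m*n U))))

  sandwich : ∀ n → q ∣ n → Wℤ q (+ n - + 1) ≤ W q (n + 1)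
  sandwich zero    _     = z≤n
  sandwich (suc P) q∣1+P = subst (W q P ≤_) (cong (W q) (sym (+-comm (suc P) 1))) (W-sandwich P q∣1+P)
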